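{- Let $M$ be a monoid of finite order $n$ with a generating set $C$ of size $|C|=m\leq n-1$. Then there exists a loopless arc-colored digraph $D$ with $\delta^+(D)\geq 1$, $\delta^-(D)\geq 1$ and $M\cong\mathrm{End}(D)$. Moreover, $D$ has $n(m+2)$ vertices, $2n(m+1)$ arcs (counted with multiplicity over colors), and the set of arc colors has size $2(m+1)$.
   Context: A digraph with $K$-colored arcs is $D=(V,\{A_c\mid c\in K\})$ with $A_c\subseteq V^2$; its number of arcs is $\sum_c|A_c|$. Loopless means no $A_c$ contains a pair $(v,v)$. $\mathrm{End}(D)$ is the monoid under composition of maps $\varphi:V\to V$ with $(u,v)\in A_c\Rightarrow(\varphi(u),\varphi(v))\in A_c$ for all $c$. $\delta^+(D)$ ($\delta^-(D)$) is the minimum over vertices of the total out-degree (in-degree) summed over all colors. -}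

module Defs where

open import Data.Nat using (ℕ; zero; suc; _+_; _*_; _∸_; _≤_)
open import Data.Fin using (Fin; zero; suc)
open import Data.Fin.Subset using (Subset; _∈_; ∣_∣)
open import Data.Bool using (Bool; true; false; if_then_else_)
open import Data.Product using (Σ; _×_; ∃)
open import Function using (_∘_; id)
open import Relation.Binary.PropositionalEquality using (_≡_; _≗_)
open import Algebra.Core using (Op₂)
open import Algebra.Structures using (IsMonoid)

∑ : (n : ℕ) → (Fin n → ℕ) → ℕ
∑ zero    f = 0
∑ (suc n) f = f zero + ∑ n (f ∘ suc)

[_] : Bool → ℕ
[ b ] = if b then 1 else 0

data Generated {n : ℕ} (_∙_ : Op₂ (Fin n)) (ε : Fin n) (C : Subset n) : Fin n → Set where
  gen-ε : Generated _∙_ ε C ε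
  gen-C : ∀ {c} → c ∈ C → Generated _∙_ ε C c
  gen-∙ : ∀ {x y} → Generated _∙_ ε C x → Generated _∙_ ε C y → Generated _∙_ ε C (x ∙ y)

Generates : {n : ℕ} → Op₂ (Fin n) → Fin n → Subset n → Set
Generates {n} _∙_ ε C = ∀ (x : Fin n) → Generated _∙_ ε C x

-- Digraphs with K-colored arcs, vertex set Fin N, colour set Fin K.
-- A c u v ≡ true  means  (u , v) ∈ A_c.

Digraph : ℕ → ℕ → Set
Digraph N K = Fin K → Fin N → Fin N → Bool

module _ {N K : ℕ} (D : Digraph N K) where

  Loopless : Set
  Loopless = ∀ (c : Fin K) (v : Fin N) → D c v v ≡ false

  outdeg : Fin N → ℕ
  outdeg u = ∑ K (λ c → ∑ N (λ v → [ D c u v ]))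

  indeg : Fin N → ℕ
  indeg v = ∑ K (λ c → ∑ N (λ u → [ D c u v ]))

  δ⁺≥ : ℕ → Set
  δ⁺≥ k = ∀ (u : Fin N) → k ≤ outdeg u

  δ⁻≥ : ℕ → Set
  δ⁻≥ k = ∀ (v : Fin N) → k ≤ indeg v

  numArcs : ℕ
  numArcs = ∑ K (λ c → ∑ N (λ u → ∑ N (λ v → [ D c u v ])))

  IsEndo : (Fin N → Fin N) → Set
  IsEndo φ = ∀ (c : Fin K) (u v : Fin N) → D c u v ≡ true → D c (φ u) (φ v) ≡ true

  record IsoToEnd {n : ℕ} (_∙_ : Op₂ (Fin n)) (ε : Fin n) : Set where
    field
      h          : Fin n → Fin N → Fin N
      h-endo     : ∀ x → IsEndo (h x)
      h-hom      : ∀ x y → h (x ∙ y) ≗ (h x ∘ h y)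
      h-ε        : h ε ≗ id
      h-injective  : ∀ x y → h x ≗ h y → x ≡ y
      h-surjective : ∀ (φ : Fin N → Fin N) → IsEndo φ → ∃ λ x → h x ≗ φ

{-# OPTIONS --safe #-}
module Submission where

-- Take generators g₀ = ε, g₁, …, gₘ (the elements of C) and vertices (x , j) with x ∈ M and
-- j ≤ m + 1.  Colour (0 , k) sends (x , 0) to (x , k + 1) and colour (1 , k) sends (x , k + 1)
-- to (x gₖ , 0); g₀ = ε gives every (x , 0) an in-arc.  Each colour class is the graph of a
-- partial map, so the endomorphisms are the maps commuting with these partial maps.  Left
-- multiplications do by associativity.  Conversely such a map f respects the layers j, and the
-- paths (x , 0) → (x , k + 1) → (x gₖ , 0) force f (x gₖ , 0) = (y gₖ , 0) whenever
-- f (x , 0) = (y , 0); as C generates M, f is left multiplication by the first coordinate of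
-- f (ε , 0).

open import Defs
open import Data.Nat using (ℕ; zero; suc; _+_; _*_; _∸_; _≤_)
open import Data.Nat.Properties
  using (module ≤-Reasoning; ≤-trans; m≤m+n; m≤n+m; +-assoc; +-comm; *-assoc; *-comm; *-zeroʳ; *-identityʳ)
open import Data.Fin using (Fin; zero; suc; combine; remQuot; _↑ˡ_; _↑ʳ_)
open import Data.Fin.Properties using (_≟_; remQuot-combine; *↔×)
open import Data.Fin.Subset using (Subset; ∣_∣; _∈_)
open import Data.Vec using (_∷_; here; there)
open import Data.Bool using (Bool; true; false; if_then_else_)
open import Data.Maybe using (Maybe; just; nothing; is-just)
open import Data.Maybe.Properties using (just-injective)
open import Data.Product using (Σ; _×_; _,_; proj₁; proj₂; ∃; ∃₂)
open import Data.Empty using (⊥-elim)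
open import Function using (_∘_; _↔_; Inverse)
open import Relation.Nullary using (does; yes)
open import Relation.Nullary.Decidable using (dec-true)
open import Relation.Binary.PropositionalEquality hiding ([_])
open import Algebra.Core using (Op₂)
open import Algebra.Structures using (IsMonoid)

∑-cong : ∀ n {f g : Fin n → ℕ} → (∀ i → f i ≡ g i) → ∑ n f ≡ ∑ n g
∑-cong zero    f≡g = refl
∑-cong (suc n) f≡g = cong₂ _+_ (f≡g zero) (∑-cong n (f≡g ∘ suc))

∑-const : ∀ n c → ∑ n (λ _ → c) ≡ n * c
∑-const zero    c = refl
∑-const (suc n) c = cong (c +_) (∑-const n c)

∑-↑ : ∀ a b (f : Fin (a + b) → ℕ) →
      ∑ (a + b) f ≡ ∑ a (λ i → f (i ↑ˡ b)) + ∑ b (λ j → f (a ↑ʳ j))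
∑-↑ zero    b f = refl
∑-↑ (suc a) b f = trans (cong (f zero +_) (∑-↑ a b (f ∘ suc))) (sym (+-assoc (f zero) _ _))

∑-combine : ∀ a b (f : Fin (a * b) → ℕ) →
            ∑ (a * b) f ≡ ∑ a (λ i → ∑ b (λ j → f (combine i j)))
∑-combine zero    b f = refl
∑-combine (suc a) b f =
  trans (∑-↑ b (a * b) f) (cong (∑ b (λ j → f (j ↑ˡ (a * b))) +_) (∑-combine a b (f ∘ (b ↑ʳ_))))

∑-remQuot : ∀ a b (f : Fin a × Fin b → ℕ) →
            ∑ (a * b) (f ∘ remQuot b) ≡ ∑ a (λ i → ∑ b (λ j → f (i , j)))
∑-remQuot a b f = trans (∑-combine a b (f ∘ remQuot b))
  (∑-cong a (λ i → ∑-cong b (λ j → cong f (remQuot-combine i j))))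

term≤∑ : ∀ n (f : Fin n → ℕ) i → f i ≤ ∑ n f
term≤∑ (suc n) f zero    = m≤m+n (f zero) _
term≤∑ (suc n) f (suc i) = ≤-trans (term≤∑ n (f ∘ suc) i) (m≤n+m _ (f zero))

∑-[≟] : ∀ n (w : Fin n) → ∑ n (λ v → [ does (v ≟ w) ]) ≡ 1
∑-[≟] (suc n) zero    = cong suc (trans (∑-const n 0) (*-zeroʳ n))
∑-[≟] (suc n) (suc w) = ∑-[≟] n w

enumerate : ∀ {n} (C : Subset n) → Fin ∣ C ∣ → Fin n
enumerate (true  ∷ C) zero    = zero
enumerate (true  ∷ C) (suc i) = suc (enumerate C i)
enumerate (false ∷ C) i       = suc (enumerate C i)

enumerate-complete : ∀ {n} (C : Subset n) {c} → c ∈ C → ∃ λ i → enumerate C i ≡ c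
enumerate-complete (true ∷ C) here = zero , refl
enumerate-complete (true ∷ C) (there c∈C) with enumerate-complete C c∈C
... | i , refl = suc i , refl
enumerate-complete (false ∷ C) (there c∈C) with enumerate-complete C c∈C
... | i , refl = i , refl

module PartialMapDigraph {N K : ℕ} {V Col : Set} (vtx : Fin N ↔ V) (col : Fin K ↔ Col)
                         (step : Col → V → Maybe V) where

  private
    module vtx = Inverse vtx
    module col = Inverse col

  hits : Maybe V → Fin N → Bool
  hits (just w) v = does (v ≟ vtx.from w)
  hits nothing  v = false

  digraph : Digraph N K
  digraph c u v = hits (step (col.to c) (vtx.to u)) v

  hits⇒≡just : ∀ mw v → hits mw v ≡ true → mw ≡ just (vtx.to v)
  hits⇒≡just (just w) v hit with v ≟ vtx.from w
  ... | yes refl = cong just (sym (vtx.strictlyInverseˡ w))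

  arc⇒step : ∀ c u v → digraph c u v ≡ true → step (col.to c) (vtx.to u) ≡ just (vtx.to v)
  arc⇒step c u v = hits⇒≡just (step (col.to c) (vtx.to u)) v

  step⇒arc : ∀ p w w′ → step p w ≡ just w′ → digraph (col.from p) (vtx.from w) (vtx.from w′) ≡ true
  step⇒arc p w w′ p:w↦w′ rewrite col.strictlyInverseˡ p | vtx.strictlyInverseˡ w | p:w↦w′ =
    dec-true (vtx.from w′ ≟ vtx.from w′) refl

  loopless : (∀ p w → step p w ≢ just w) → Loopless digraph
  loopless no-fixpoint c v with digraph c v v in arc
  ... | false = refl
  ... | true  = ⊥-elim (no-fixpoint (col.to c) (vtx.to v) (arc⇒step c v v arc))

  δ⁺≥1 : (∀ w → ∃₂ λ p w′ → step p w ≡ just w′) → δ⁺≥ digraph 1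
  δ⁺≥1 out u with out (vtx.to u)
  ... | p , w′ , p:u↦w′ = begin
    1                                        ≡⟨ cong [_] (sym arc) ⟩
    [ digraph (col.from p) u (vtx.from w′) ] ≤⟨ term≤∑ N _ (vtx.from w′) ⟩
    ∑ N (λ v → [ digraph (col.from p) u v ]) ≤⟨ term≤∑ K _ (col.from p) ⟩
    outdeg digraph u                         ∎
    where
    open ≤-Reasoning
    arc : digraph (col.from p) u (vtx.from w′) ≡ true
    arc = subst (λ u′ → digraph (col.from p) u′ (vtx.from w′) ≡ true)
                (vtx.strictlyInverseʳ u) (step⇒arc p (vtx.to u) w′ p:u↦w′)

  δ⁻≥1 : (∀ w′ → ∃₂ λ p w → step p w ≡ just w′) → δ⁻≥ digraph 1
  δ⁻≥1 into v with into (vtx.to v)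
  ... | p , w , p:w↦v = begin
    1                                        ≡⟨ cong [_] (sym arc) ⟩
    [ digraph (col.from p) (vtx.from w) v ]  ≤⟨ term≤∑ N _ (vtx.from w) ⟩
    ∑ N (λ u → [ digraph (col.from p) u v ]) ≤⟨ term≤∑ K _ (col.from p) ⟩
    indeg digraph v                          ∎
    where
    open ≤-Reasoning
    arc : digraph (col.from p) (vtx.from w) v ≡ true
    arc = subst (λ v′ → digraph (col.from p) (vtx.from w) v′ ≡ true)
                (vtx.strictlyInverseʳ v) (step⇒arc p w (vtx.to v) p:w↦v)

  ∑-hits : ∀ mw → ∑ N (λ v → [ hits mw v ]) ≡ [ is-just mw ]
  ∑-hits (just w) = ∑-[≟] N (vtx.from w)
  ∑-hits nothing  = trans (∑-const N 0) (*-zeroʳ N)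

  numArcs≡∑is-just : numArcs digraph ≡ ∑ K (λ c → ∑ N (λ u → [ is-just (step (col.to c) (vtx.to u)) ]))
  numArcs≡∑is-just = ∑-cong K (λ c → ∑-cong N (λ u → ∑-hits (step (col.to c) (vtx.to u))))

  Preserves : (V → V) → Set
  Preserves f = ∀ p w w′ → step p w ≡ just w′ → step p (f w) ≡ just (f w′)

  conjugate : (V → V) → Fin N → Fin N
  conjugate f = vtx.from ∘ f ∘ vtx.to

  to-conjugate-from : ∀ f w → vtx.to (conjugate f (vtx.from w)) ≡ f w
  to-conjugate-from f w = trans (vtx.strictlyInverseˡ _) (cong f (vtx.strictlyInverseˡ w))

  preserves⇒endo : ∀ f → Preserves f → IsEndo digraph (conjugate f)
  preserves⇒endo f pres c u v arc = subst (λ c′ → digraph c′ _ _ ≡ true) (col.strictlyInverseʳ c)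
    (step⇒arc (col.to c) (f (vtx.to u)) (f (vtx.to v)) (pres _ _ _ (arc⇒step c u v arc)))

  endo⇒preserves : ∀ φ → IsEndo digraph φ → Preserves (vtx.to ∘ φ ∘ vtx.from)
  endo⇒preserves φ endo p w w′ p:w↦w′ = subst (λ p′ → step p′ _ ≡ _) (col.strictlyInverseˡ p)
    (arc⇒step (col.from p) (φ (vtx.from w)) (φ (vtx.from w′))
      (endo (col.from p) (vtx.from w) (vtx.from w′) (step⇒arc p w w′ p:w↦w′)))

  isoToEnd : ∀ {n} {_∙_ : Op₂ (Fin n)} {ε : Fin n} (act : Fin n → V → V) →
             (∀ a → Preserves (act a)) →
             (∀ x y w → act (x ∙ y) w ≡ act x (act y w)) →
             (∀ w → act ε w ≡ w) →
             (∀ x y → act x ≗ act y → x ≡ y) →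
             (∀ f → Preserves f → ∃ λ a → act a ≗ f) →
             IsoToEnd digraph _∙_ ε
  isoToEnd act act-preserves act-∙ act-ε act-injective act-onto = record
    { h            = conjugate ∘ act
    ; h-endo       = λ a → preserves⇒endo (act a) (act-preserves a)
    ; h-hom        = λ x y u → cong vtx.from (trans (act-∙ x y (vtx.to u))
                       (cong (act x) (sym (vtx.strictlyInverseˡ _))))
    ; h-ε          = λ u → trans (cong vtx.from (act-ε (vtx.to u))) (vtx.strictlyInverseʳ u)
    ; h-injective  = λ x y hx≗hy → act-injective x y λ w → begin
        act x w                                 ≡⟨ sym (to-conjugate-from (act x) w) ⟩
        vtx.to (conjugate (act x) (vtx.from w)) ≡⟨ cong vtx.to (hx≗hy (vtx.from w)) ⟩
        vtx.to (conjugate (act y) (vtx.from w)) ≡⟨ to-conjugate-from (act y) w ⟩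
        act y w                                 ∎
    ; h-surjective = λ φ endo → let (a , act-a≗) = act-onto _ (endo⇒preserves φ endo) in
        a , λ u → begin
          vtx.from (act a (vtx.to u))                 ≡⟨ cong vtx.from (act-a≗ (vtx.to u)) ⟩
          vtx.from (vtx.to (φ (vtx.from (vtx.to u)))) ≡⟨ vtx.strictlyInverseʳ _ ⟩
          φ (vtx.from (vtx.to u))                     ≡⟨ cong φ (vtx.strictlyInverseʳ u) ⟩
          φ u                                         ∎
    }
    where open ≡-Reasoning

module GeneratorDigraph {n : ℕ} {_∙_ : Op₂ (Fin n)} {ε : Fin n} (isMonoid : IsMonoid _≡_ _∙_ ε)
                        (C : Subset n) (generates : Generates _∙_ ε C) where

  open IsMonoid isMonoid using (assoc; identityˡ; identityʳ)

  m : ℕ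
  m = ∣ C ∣

  generator : Fin (suc m) → Fin n
  generator zero    = ε
  generator (suc i) = enumerate C i

  Vertex : Set
  Vertex = Fin n × Fin (suc (suc m))

  Colour : Set
  Colour = Fin 2 × Fin (suc m)

  step : Colour → Vertex → Maybe Vertex
  step (zero     , k) (x , zero)  = just (x , suc k)
  step (zero     , k) (x , suc j) = nothing
  step (suc zero , k) (x , zero)  = nothing
  step (suc zero , k) (x , suc j) = if does (j ≟ k) then just (x ∙ generator k , zero) else nothing

  open PartialMapDigraph (*↔× {n} {suc (suc m)}) (*↔× {2} {suc m}) step

  step-down : ∀ x k → step (suc zero , k) (x , suc k) ≡ just (x ∙ generator k , zero)
  step-down x k rewrite dec-true (k ≟ k) refl = refl

  step-up⁻¹ : ∀ k w w′ → step (zero , k) w ≡ just w′ → w ≡ (proj₁ w , zero) × w′ ≡ (proj₁ w , suc k)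
  step-up⁻¹ k (x , zero) w′ refl = refl , refl

  step-no-fixpoint : ∀ p w → step p w ≢ just w
  step-no-fixpoint (zero     , k) (x , zero)  ()
  step-no-fixpoint (suc zero , k) (x , suc j) down with does (j ≟ k)
  step-no-fixpoint (suc zero , k) (x , suc j) () | true
  step-no-fixpoint (suc zero , k) (x , suc j) () | false

  step-out : ∀ w → ∃₂ λ p w′ → step p w ≡ just w′
  step-out (x , zero)  = (zero , zero) , (x , suc zero) , refl
  step-out (x , suc k) = (suc zero , k) , (x ∙ generator k , zero) , step-down x k

  step-in : ∀ w′ → ∃₂ λ p w → step p w ≡ just w′
  step-in (x , zero)  = (suc zero , zero) , (x , suc zero) ,
    trans (step-down x zero) (cong (λ y → just (y , zero)) (identityʳ x))
  step-in (x , suc k) = (zero , k) , (x , zero) , refl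

  is-just-if : ∀ (b : Bool) (w : Vertex) → is-just (if b then just w else nothing) ≡ b
  is-just-if true  w = refl
  is-just-if false w = refl

  ∑-is-just-step : ∀ p → ∑ n (λ x → ∑ (suc (suc m)) (λ j → [ is-just (step p (x , j)) ])) ≡ n
  ∑-is-just-step p = trans (∑-cong n (λ x → one-arc-per-element p x)) (trans (∑-const n 1) (*-identityʳ n))
    where
    one-arc-per-element : ∀ p x → ∑ (suc (suc m)) (λ j → [ is-just (step p (x , j)) ]) ≡ 1
    one-arc-per-element (zero , k) x = cong suc (trans (∑-const (suc m) 0) (*-zeroʳ m))
    one-arc-per-element (suc zero , k) x = trans
      (∑-cong (suc m) (λ j → cong [_] (is-just-if (does (j ≟ k)) (x ∙ generator k , zero))))
      (∑-[≟] (suc m) k)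

  leftMul : Fin n → Vertex → Vertex
  leftMul a (x , j) = (a ∙ x , j)

  leftMul-preserves : ∀ a → Preserves (leftMul a)
  leftMul-preserves a (zero     , k) (x , zero)  w′ refl = refl
  leftMul-preserves a (suc zero , k) (x , suc j) w′ down with does (j ≟ k)
  leftMul-preserves a (suc zero , k) (x , suc j) w′ refl | true =
    cong (λ y → just (y , zero)) (assoc a x (generator k))

  module _ (f : Vertex → Vertex) (preserves : Preserves f) where

    base : Fin n → Fin n
    base x = proj₁ (f (x , zero))

    f-on-layers : ∀ x k → f (x , zero) ≡ (base x , zero) × f (x , suc k) ≡ (base x , suc k)
    f-on-layers x k = step-up⁻¹ k (f (x , zero)) (f (x , suc k)) (preserves (zero , k) _ _ refl)

    f-down : ∀ x y k → f (x , zero) ≡ (y , zero) → f (x ∙ generator k , zero) ≡ (y ∙ generator k , zero)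
    f-down x y k fx≡y = just-injective (begin
      just (f (x ∙ generator k , zero))    ≡⟨ sym (preserves (suc zero , k) _ _ (step-down x k)) ⟩
      step (suc zero , k) (f (x , suc k))  ≡⟨ cong (step (suc zero , k)) f-satellite ⟩
      step (suc zero , k) (y , suc k)      ≡⟨ step-down y k ⟩
      just (y ∙ generator k , zero)        ∎)
      where
      open ≡-Reasoning
      f-satellite : f (x , suc k) ≡ (y , suc k)
      f-satellite = trans (proj₂ (f-on-layers x k)) (cong (λ z → (proj₁ z , suc k)) fx≡y)

    f-rightMul : ∀ {t} → Generated _∙_ ε C t →
                 ∀ x y → f (x , zero) ≡ (y , zero) → f (x ∙ t , zero) ≡ (y ∙ t , zero)
    f-rightMul gen-ε x y fx≡y rewrite identityʳ x | identityʳ y = fx≡y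
    f-rightMul (gen-C c∈C) x y fx≡y with enumerate-complete C c∈C
    ... | i , refl = f-down x y (suc i) fx≡y
    f-rightMul (gen-∙ {t₁} {t₂} gt₁ gt₂) x y fx≡y
      rewrite sym (assoc x t₁ t₂) | sym (assoc y t₁ t₂) =
      f-rightMul gt₂ (x ∙ t₁) (y ∙ t₁) (f-rightMul gt₁ x y fx≡y)

    f-base : ∀ x → f (x , zero) ≡ (base ε ∙ x , zero)
    f-base x = trans (cong (λ z → f (z , zero)) (sym (identityˡ x)))
      (f-rightMul (generates x) ε (base ε) (proj₁ (f-on-layers ε zero)))

    f≗leftMul : ∀ w → f w ≡ leftMul (base ε) w
    f≗leftMul (x , zero)  = f-base x
    f≗leftMul (x , suc k) = trans (proj₂ (f-on-layers x k)) (cong (λ z → (proj₁ z , suc k)) (f-base x))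

  leftMul-∙ : ∀ x y w → leftMul (x ∙ y) w ≡ leftMul x (leftMul y w)
  leftMul-∙ x y (z , j) = cong (_, j) (assoc x y z)

  leftMul-ε : ∀ w → leftMul ε w ≡ w
  leftMul-ε (x , j) = cong (_, j) (identityˡ x)

  leftMul-injective : ∀ x y → leftMul x ≗ leftMul y → x ≡ y
  leftMul-injective x y x≗y = trans (sym (identityʳ x)) (trans (cong proj₁ (x≗y (ε , zero))) (identityʳ y))

  numArcs-digraph : numArcs digraph ≡ 2 * n * suc m
  numArcs-digraph = begin
    numArcs digraph                     ≡⟨ numArcs≡∑is-just ⟩
    ∑ (2 * suc m) (λ c → ∑ (n * suc (suc m)) (arcsAt c ∘ remQuot (suc (suc m))))
                                        ≡⟨ ∑-cong (2 * suc m) (λ c → trans (∑-remQuot n (suc (suc m)) (arcsAt c))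
                                                                           (∑-is-just-step (remQuot (suc m) c))) ⟩
    ∑ (2 * suc m) (λ _ → n)             ≡⟨ ∑-const (2 * suc m) n ⟩
    2 * suc m * n                       ≡⟨ *-assoc 2 (suc m) n ⟩
    2 * (suc m * n)                     ≡⟨ cong (2 *_) (*-comm (suc m) n) ⟩
    2 * (n * suc m)                     ≡⟨ *-assoc 2 n (suc m) ⟨
    2 * n * suc m                       ∎
    where
    open ≡-Reasoning
    arcsAt : Fin (2 * suc m) → Vertex → ℕ
    arcsAt c w = [ is-just (step (remQuot (suc m) c) w) ]

  endRepresentation : Σ (Digraph (n * suc (suc m)) (2 * suc m)) λ D →
    Loopless D × δ⁺≥ D 1 × δ⁻≥ D 1 × IsoToEnd D _∙_ ε × numArcs D ≡ 2 * n * suc m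
  endRepresentation = digraph , loopless step-no-fixpoint , δ⁺≥1 step-out , δ⁻≥1 step-in ,
    isoToEnd leftMul leftMul-preserves leftMul-∙ leftMul-ε leftMul-injective
      (λ f preserves → base f preserves ε , λ w → sym (f≗leftMul f preserves w)) ,
    numArcs-digraph

lemma6 : (n m : ℕ) (_∙_ : Op₂ (Fin n)) (ε : Fin n) → IsMonoid _≡_ _∙_ ε →
    (C : Subset n) → ∣ C ∣ ≡ m → Generates _∙_ ε C → m ≤ n ∸ 1 →
    Σ (Digraph (n * (m + 2)) (2 * (m + 1))) λ D →
      Loopless D × δ⁺≥ D 1 × δ⁻≥ D 1 × IsoToEnd D _∙_ ε × numArcs D ≡ 2 * n * (m + 1)
lemma6 n .(∣ C ∣) _∙_ ε isMonoid C refl generates _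
  rewrite +-comm ∣ C ∣ 1 | +-comm ∣ C ∣ 2 = GeneratorDigraph.endRepresentation isMonoid C generates
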